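{- Let $\delta$ and $k$ be positive integers with $\delta < k$. If $G$ is a graph with minimum degree $\delta$ in which every vertex of degree $\delta$ has a neighbor of degree at least $k$, then $d(G) \geq \delta + (k - \delta)/(k+1)$. If, in addition, every vertex of $G$ of degree at least $k$ has a neighbor of degree strictly larger than $\delta$, then $d(G) \geq \delta + (k-\delta)/k$.
   Context: Graphs are finite and simple; $d(G)$ denotes the average degree of the vertices of $G$. -}

module Defs where

open import Data.Nat using (ℕ; zero; suc)
open import Data.Bool using (Bool; true; false; if_then_else_)
open import Data.Fin using (Fin)
open import Data.List using (map; allFin)
open import Data.Nat.ListAction using (sum)
open import Data.Integer using (+_)
open import Data.Rational using (ℚ; _/_)
open import Relation.Binary.PropositionalEquality using (_≡_)

record Graph (n : ℕ) : Set where
  field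
    adj    : Fin n → Fin n → Bool
    sym    : ∀ u v → adj u v ≡ adj v u
    irrefl : ∀ v → adj v v ≡ false

open Graph public

Adjacent : ∀ {n} → Graph n → Fin n → Fin n → Set
Adjacent G u v = adj G u v ≡ true

degree : ∀ {n} → Graph n → Fin n → ℕ
degree {n} G v = sum (map (λ u → if adj G v u then 1 else 0) (allFin n))

degreeSum : ∀ {n} → Graph n → ℕ
degreeSum {n} G = sum (map (degree G) (allFin n))

-- average degree d(G) = (sum of degrees) / |V(G)|  (set to 0 for the empty graph)
avgDegree : ∀ {n} → Graph n → ℚ
avgDegree {zero}  G = + 0 / 1
avgDegree {suc m} G = + degreeSum G / suc m

module Submission where

-- Call a vertex minimal if its degree is δ and large if its degree is at least k, and let
-- e = k − δ.  Give each vertex v the charge (k+1)·d(v) − (δ(k+1) + e): a minimal vertex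
-- has charge −e, a large vertex at least e·d(v), every other vertex a nonnegative charge.
-- Since every minimal vertex has a large neighbour, the number of minimal vertices is at
-- most the number of minimal–large edges, hence at most the degree sum of the large
-- vertices.  So the total charge is nonnegative: (k+1)·∑d ≥ n(δ(k+1) + e).
-- If moreover every large vertex u has a neighbour that is not minimal, u has at most
-- d(u) − 1 minimal neighbours, and the same count with the charge k·d(v) − (δk + e) and
-- the weight d(v) − 1 on large vertices gives k·∑d ≥ n(δk + e).

module DegreeSumBounds where

  open import Data.Bool.Base using (Bool; true; false; if_then_else_)
  open import Data.Fin.Base using (Fin; zero; suc)
  open import Data.Integer.Base as ℤ using (+_; +≤+)
  import Data.Integer.Properties as ℤ
  open import Data.List.Base using ([]; _∷_; map; allFin; tabulate)
  open import Data.List.Properties using (map-tabulate)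
  open import Data.Nat.Base using (ℕ; zero; suc; pred; _+_; _*_; _∸_; _≤_; _<_; z≤n; z<s)
  import Data.Nat.ListAction as List using (sum)
  open import Data.Nat.Properties
  open import Data.Nat.Tactic.RingSolver using (solve)
  open import Data.Product.Base as Product using (∃; _×_; _,_)
  open import Data.Rational.Base as ℚ using (_/_; toℚᵘ)
  open import Data.Rational.Properties using (toℚᵘ-cancel-≤; toℚᵘ-homo-+; toℚᵘ-fromℚᵘ)
  open import Data.Rational.Unnormalised.Base as ℚᵘ using (mkℚᵘ; *≤*)
  import Data.Rational.Unnormalised.Properties as ℚᵘ
  open import Data.Vec.Functional using (Vector)
  open import Defs using (Graph; adj; Adjacent; degree; degreeSum)
  open import Function.Base using (_∘_; id)
  open import Relation.Binary.PropositionalEquality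
  open import Relation.Nullary using (¬_; Dec; yes; no; does; contradiction)
  open import Relation.Nullary.Decidable using (dec-true; dec-false)
  open import Relation.Unary using (Pred; Decidable)

  open import Algebra.Properties.Semiring.Sum +-*-semiring
    using (sum; sum-syntax; ∑-distrib-+; ∑-comm; *-distribˡ-sum; sum-cong-≗)

  sum-tabulate : ∀ n (f : Fin n → ℕ) → List.sum (tabulate f) ≡ sum f
  sum-tabulate zero    f = refl
  sum-tabulate (suc n) f = cong (_+_ (f zero)) (sum-tabulate n (f ∘ suc))

  sum-map-allFin : ∀ n (f : Fin n → ℕ) → List.sum (map f (allFin n)) ≡ sum f
  sum-map-allFin n f = trans (cong List.sum (map-tabulate id f)) (sum-tabulate n f)

  ∑-const : ∀ n c → ∑[ i < n ] c ≡ n * c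
  ∑-const zero    c = refl
  ∑-const (suc n) c = cong (_+_ c) (∑-const n c)

  ∑-mono-≤ : ∀ {n} {f g : Vector ℕ n} → (∀ i → f i ≤ g i) → sum f ≤ sum g
  ∑-mono-≤ {zero}  f≤g = z≤n
  ∑-mono-≤ {suc n} f≤g = +-mono-≤ (f≤g zero) (∑-mono-≤ (f≤g ∘ suc))

  ∑-mono-< : ∀ {n} {f g : Vector ℕ n} → (∀ i → f i ≤ g i) →
             ∀ {j} → f j < g j → sum f < sum g
  ∑-mono-< f≤g {zero}  fj<gj = +-mono-<-≤ fj<gj (∑-mono-≤ (f≤g ∘ suc))
  ∑-mono-< f≤g {suc j} fj<gj = +-mono-≤-< (f≤g zero) (∑-mono-< (f≤g ∘ suc) fj<gj)

  term≤∑ : ∀ {n} (f : Vector ℕ n) i → f i ≤ sum f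
  term≤∑ f zero    = m≤m+n (f zero) _
  term≤∑ f (suc i) = ≤-trans (term≤∑ (f ∘ suc) i) (m≤n+m _ (f zero))

  -- The hypothesis says c·d(i) − C ≥ e·(g(i) − s(i)) in ℤ, stated without subtraction.
  discharging : ∀ {n} C c e (d s g : Vector ℕ n) →
    (∀ i → C + e * g i ≤ c * d i + e * s i) → sum s ≤ sum g → n * C ≤ c * sum d
  discharging {n} C c e d s g charge ∑s≤∑g =
    +-cancelʳ-≤ (e * sum g) (n * C) (c * sum d) (begin
      n * C + e * sum g
        ≡⟨ cong₂ _+_ (sym (∑-const n C)) (*-distribˡ-sum e g) ⟩
      ∑[ i < n ] C + ∑[ i < n ] (e * g i)
        ≡⟨ ∑-distrib-+ (λ _ → C) (λ i → e * g i) ⟨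
      ∑[ i < n ] (C + e * g i)
        ≤⟨ ∑-mono-≤ charge ⟩
      ∑[ i < n ] (c * d i + e * s i)
        ≡⟨ ∑-distrib-+ (λ i → c * d i) (λ i → e * s i) ⟩
      ∑[ i < n ] (c * d i) + ∑[ i < n ] (e * s i)
        ≡⟨ cong₂ _+_ (*-distribˡ-sum c d) (*-distribˡ-sum e s) ⟨
      c * sum d + e * sum s
        ≤⟨ +-monoʳ-≤ (c * sum d) (*-monoʳ-≤ e ∑s≤∑g) ⟩
      c * sum d + e * sum g
        ∎)
    where open ≤-Reasoning

  𝟙 : Bool → ℕ
  𝟙 b = if b then 1 else 0

  𝟙[_] : ∀ {a} {A : Set a} → Dec A → ℕ
  𝟙[ a? ] = 𝟙 (does a?)

  𝟙*n≤n : ∀ b n → 𝟙 b * n ≤ n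
  𝟙*n≤n true  n = ≤-reflexive (+-identityʳ n)
  𝟙*n≤n false n = z≤n

  module _ {n} (G : Graph n) where

    degree≡∑ : ∀ u → degree G u ≡ ∑[ v < n ] 𝟙 (adj G u v)
    degree≡∑ u = sum-map-allFin n (λ v → 𝟙 (adj G u v))

    degreeSum≡∑ : degreeSum G ≡ sum (degree G)
    degreeSum≡∑ = sum-map-allFin n (degree G)

    neighboursIn : ∀ {p} {P : Pred (Fin n) p} → Decidable P → Fin n → ℕ
    neighboursIn P? u = ∑[ v < n ] (𝟙[ P? v ] * 𝟙 (adj G u v))

    neighboursIn≤degree : ∀ {p} {P : Pred (Fin n) p} (P? : Decidable P) u →
      neighboursIn P? u ≤ degree G u
    neighboursIn≤degree P? u =
      subst (neighboursIn P? u ≤_) (sym (degree≡∑ u)) (∑-mono-≤ λ v → 𝟙*n≤n (does (P? v)) _)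

    neighboursIn<degree : ∀ {p} {P : Pred (Fin n) p} (P? : Decidable P) {u w} →
      Adjacent G u w → ¬ P w → neighboursIn P? u < degree G u
    neighboursIn<degree P? {u} {w} uw ¬Pw =
      subst (neighboursIn P? u <_) (sym (degree≡∑ u))
        (∑-mono-< (λ v → 𝟙*n≤n (does (P? v)) _) term-at-w<)
      where
      term-at-w< : 𝟙[ P? w ] * 𝟙 (adj G u w) < 𝟙 (adj G u w)
      term-at-w< rewrite dec-false (P? w) ¬Pw | uw = z<s

    count≤∑neighboursIn : ∀ {p q} {P : Pred (Fin n) p} {Q : Pred (Fin n) q}
      (P? : Decidable P) (Q? : Decidable Q) →
      (∀ v → P v → ∃ λ u → Adjacent G v u × Q u) →
      ∑[ v < n ] 𝟙[ P? v ] ≤ ∑[ u < n ] (𝟙[ Q? u ] * neighboursIn P? u)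
    count≤∑neighboursIn P? Q? has-Q-neighbour = begin
      ∑[ v < n ] 𝟙[ P? v ]
        ≤⟨ ∑-mono-≤ counted-at-neighbour ⟩
      ∑[ v < n ] ∑[ u < n ] (𝟙[ Q? u ] * edge u v)
        ≡⟨ ∑-comm (λ v u → 𝟙[ Q? u ] * edge u v) ⟩
      ∑[ u < n ] ∑[ v < n ] (𝟙[ Q? u ] * edge u v)
        ≡⟨ sum-cong-≗ (λ u → *-distribˡ-sum 𝟙[ Q? u ] (edge u)) ⟨
      ∑[ u < n ] (𝟙[ Q? u ] * neighboursIn P? u)
        ∎
      where
      open ≤-Reasoning
      edge : Fin n → Fin n → ℕ
      edge u v = 𝟙[ P? v ] * 𝟙 (adj G u v)
      counted-at-neighbour : ∀ v → 𝟙[ P? v ] ≤ ∑[ u < n ] (𝟙[ Q? u ] * edge u v)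
      counted-at-neighbour v with P? v
      ... | no _   = z≤n
      ... | yes Pv with has-Q-neighbour v Pv
      ...   | u , vu , Qu = ≤-trans (≤-reflexive (sym term-at-u≡1)) (term≤∑ _ u)
        where
        term-at-u≡1 : 𝟙[ Q? u ] * (1 * 𝟙 (adj G u v)) ≡ 1
        term-at-u≡1 rewrite dec-true (Q? u) Qu | Graph.sym G u v | vu = refl

    ∑neighboursIn≤∑pred-degree : ∀ {p q} {P : Pred (Fin n) p} {Q : Pred (Fin n) q}
      (P? : Decidable P) (Q? : Decidable Q) →
      (∀ u → Q u → ∃ λ w → Adjacent G u w × ¬ P w) →
      ∑[ u < n ] (𝟙[ Q? u ] * neighboursIn P? u) ≤
      ∑[ u < n ] (𝟙[ Q? u ] * pred (degree G u))
    ∑neighboursIn≤∑pred-degree P? Q? has-neighbour-outside-P = ∑-mono-≤ bound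
      where
      bound : ∀ u → 𝟙[ Q? u ] * neighboursIn P? u ≤ 𝟙[ Q? u ] * pred (degree G u)
      bound u with Q? u
      ... | no _   = z≤n
      ... | yes Qu with has-neighbour-outside-P u Qu
      ...   | w , uw , ¬Pw = *-monoʳ-≤ 1 (<⇒≤pred (neighboursIn<degree P? uw ¬Pw))

  pointwise-bound : ∀ {δ k e d} → k ≡ δ + e → 0 < e → δ ≤ d →
    (d≟δ : Dec (d ≡ δ)) (k≤?d : Dec (k ≤ d)) →
    δ * suc k + e + e * (𝟙[ k≤?d ] * d) ≤ suc k * d + e * 𝟙[ d≟δ ]
  pointwise-bound {δ} {e = e} refl 0<e _ (yes refl) (yes k≤δ) =
    contradiction k≤δ (<⇒≱ (m<m+n δ 0<e))
  pointwise-bound {δ} {e = e} refl _   _ (yes refl) (no _)    = ≤-reflexive (solve (δ ∷ e ∷ []))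
  pointwise-bound {δ} {e = e} {d} refl _ _ (no _) (yes k≤d) = begin
    δ * suc (δ + e) + e + e * (1 * d)  ≡⟨ solve (δ ∷ e ∷ d ∷ []) ⟩
    suc δ * (δ + e) + e * d            ≤⟨ +-monoˡ-≤ (e * d) (*-monoʳ-≤ (suc δ) k≤d) ⟩
    suc δ * d + e * d                  ≡⟨ solve (δ ∷ e ∷ d ∷ []) ⟩
    suc (δ + e) * d + e * 0            ∎
    where open ≤-Reasoning
  pointwise-bound {δ} {e = e} {d} refl _ δ≤d (no d≢δ) (no _) = begin
    δ * suc (δ + e) + e + e * (0 * d)  ≡⟨ solve (δ ∷ e ∷ d ∷ []) ⟩
    suc (δ + e) * δ + e                ≤⟨ +-monoʳ-≤ (suc (δ + e) * δ) (m≤n+m e (suc δ)) ⟩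
    suc (δ + e) * δ + suc (δ + e)      ≡⟨ solve (δ ∷ e ∷ []) ⟩
    suc (δ + e) * suc δ                ≤⟨ *-monoʳ-≤ (suc (δ + e)) δ<d ⟩
    suc (δ + e) * d                    ≡⟨ solve (δ ∷ e ∷ d ∷ []) ⟩
    suc (δ + e) * d + e * 0            ∎
    where
    open ≤-Reasoning
    δ<d : δ < d
    δ<d = ≤∧≢⇒< δ≤d (≢-sym d≢δ)

  pointwise-bound′ : ∀ {δ k e d} → k ≡ δ + e → 0 < e → δ ≤ d →
    (d≟δ : Dec (d ≡ δ)) (k≤?d : Dec (k ≤ d)) →
    δ * k + e + e * (𝟙[ k≤?d ] * pred d) ≤ k * d + e * 𝟙[ d≟δ ]
  pointwise-bound′ {δ} {e = e} refl 0<e _ (yes refl) (yes k≤δ) =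
    contradiction k≤δ (<⇒≱ (m<m+n δ 0<e))
  pointwise-bound′ {δ} {e = e} refl _   _ (yes refl) (no _)    = ≤-reflexive (solve (δ ∷ e ∷ []))
  pointwise-bound′ {δ} {e = e} {zero} refl 0<e _ (no _) (yes k≤0) =
    contradiction k≤0 (<⇒≱ (≤-trans 0<e (m≤n+m e δ)))
  pointwise-bound′ {δ} {e = e} {suc d} refl _ _ (no _) (yes k≤d) = begin
    δ * (δ + e) + e + e * (1 * d)  ≡⟨ solve (δ ∷ e ∷ d ∷ []) ⟩
    δ * (δ + e) + e * suc d        ≤⟨ +-monoˡ-≤ (e * suc d) (*-monoʳ-≤ δ k≤d) ⟩
    δ * suc d + e * suc d          ≡⟨ solve (δ ∷ e ∷ d ∷ []) ⟩
    (δ + e) * suc d + e * 0        ∎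
    where open ≤-Reasoning
  pointwise-bound′ {δ} {e = e} {d} refl _ δ≤d (no d≢δ) (no _) = begin
    δ * (δ + e) + e + e * (0 * pred d)  ≡⟨ solve (δ ∷ e ∷ []) ⟩
    (δ + e) * δ + e                     ≤⟨ +-monoʳ-≤ ((δ + e) * δ) (m≤n+m e δ) ⟩
    (δ + e) * δ + (δ + e)               ≡⟨ solve (δ ∷ e ∷ []) ⟩
    (δ + e) * suc δ                     ≤⟨ *-monoʳ-≤ (δ + e) δ<d ⟩
    (δ + e) * d                         ≡⟨ solve (δ ∷ e ∷ d ∷ []) ⟩
    (δ + e) * d + e * 0                 ∎
    where
    open ≤-Reasoning
    δ<d : δ < d
    δ<d = ≤∧≢⇒< δ≤d (≢-sym d≢δ)

  module _ {n} (G : Graph n) {δ k} (δ<k : δ < k) (δ≤degree : ∀ v → δ ≤ degree G v)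
           (has-large-neighbour :
              ∀ v → degree G v ≡ δ → ∃ λ u → Adjacent G v u × k ≤ degree G u)
           where

    private
      k≡δ+[k∸δ] : k ≡ δ + (k ∸ δ)
      k≡δ+[k∸δ] = sym (m+[n∸m]≡n (<⇒≤ δ<k))

      0<k∸δ : 0 < k ∸ δ
      0<k∸δ = m<n⇒0<n∸m δ<k

      minimal? : Decidable (λ v → degree G v ≡ δ)
      minimal? v = degree G v ≟ δ

      large? : Decidable (λ v → k ≤ degree G v)
      large? v = k ≤? degree G v

      #minimal≤∑neighboursIn :
        ∑[ v < n ] 𝟙[ minimal? v ] ≤ ∑[ u < n ] (𝟙[ large? u ] * neighboursIn G minimal? u)
      #minimal≤∑neighboursIn = count≤∑neighboursIn G minimal? large? has-large-neighbour

    degreeSum-bound : n * (δ * suc k + (k ∸ δ)) ≤ suc k * degreeSum G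
    degreeSum-bound = subst (λ D → n * _ ≤ suc k * D) (sym (degreeSum≡∑ G))
      (discharging _ (suc k) (k ∸ δ) (degree G) _ _
        (λ v → pointwise-bound k≡δ+[k∸δ] 0<k∸δ (δ≤degree v) (minimal? v) (large? v))
        (≤-trans #minimal≤∑neighboursIn
          (∑-mono-≤ λ u → *-monoʳ-≤ (𝟙[ large? u ]) (neighboursIn≤degree G minimal? u))))

    degreeSum-bound′ : (∀ v → k ≤ degree G v → ∃ λ u → Adjacent G v u × δ < degree G u) →
      n * (δ * k + (k ∸ δ)) ≤ k * degreeSum G
    degreeSum-bound′ has-nonminimal-neighbour =
      subst (λ D → n * _ ≤ k * D) (sym (degreeSum≡∑ G))
        (discharging _ k (k ∸ δ) (degree G) _ _
          (λ v → pointwise-bound′ k≡δ+[k∸δ] 0<k∸δ (δ≤degree v) (minimal? v) (large? v))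
          (≤-trans #minimal≤∑neighboursIn
            (∑neighboursIn≤∑pred-degree G minimal? large?
              λ u large → Product.map₂ (Product.map₂ >⇒≢) (has-nonminimal-neighbour u large))))

  x/1+y/c≤D/mᵘ : ∀ x y c D m → suc m * (x * suc c + y) ≤ suc c * D →
    mkℚᵘ (+ x) 0 ℚᵘ.+ mkℚᵘ (+ y) c ℚᵘ.≤ mkℚᵘ (+ D) m
  x/1+y/c≤D/mᵘ x y c D m h = *≤* (subst₂ ℤ._≤_ numerators denominators (+≤+ h))
    where
    open ≡-Reasoning
    numerators : + (suc m * (x * suc c + y)) ≡ (+ x ℤ.* + suc c ℤ.+ + y ℤ.* + 1) ℤ.* + suc m
    numerators = begin
      + (suc m * (x * suc c + y))                    ≡⟨ cong +_ (*-comm (suc m) _) ⟩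
      + ((x * suc c + y) * suc m)                    ≡⟨ ℤ.pos-* (x * suc c + y) (suc m) ⟩
      + (x * suc c + y) ℤ.* + suc m                  ≡⟨ cong (ℤ._* + suc m) x*c+y ⟩
      (+ x ℤ.* + suc c ℤ.+ + y ℤ.* + 1) ℤ.* + suc m  ∎
      where
      x*c+y : + (x * suc c + y) ≡ + x ℤ.* + suc c ℤ.+ + y ℤ.* + 1
      x*c+y = cong₂ ℤ._+_ (ℤ.pos-* x (suc c)) (sym (ℤ.*-identityʳ (+ y)))
    denominators : + (suc c * D) ≡ + D ℤ.* + suc (c + 0)
    denominators = begin
      + (suc c * D)          ≡⟨ cong +_ (*-comm (suc c) D) ⟩
      + (D * suc c)          ≡⟨ ℤ.pos-* D (suc c) ⟩
      + D ℤ.* + suc c        ≡⟨ cong (λ t → + D ℤ.* + suc t) (sym (+-identityʳ c)) ⟩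
      + D ℤ.* + suc (c + 0)  ∎

  x/1+y/c≤D/m : ∀ x y c D m → suc m * (x * suc c + y) ≤ suc c * D →
    + x / 1 ℚ.+ + y / suc c ℚ.≤ + D / suc m
  x/1+y/c≤D/m x y c D m h = toℚᵘ-cancel-≤ (begin
    toℚᵘ (+ x / 1 ℚ.+ + y / suc c)
      ≃⟨ toℚᵘ-homo-+ (+ x / 1) (+ y / suc c) ⟩
    toℚᵘ (+ x / 1) ℚᵘ.+ toℚᵘ (+ y / suc c)
      ≃⟨ ℚᵘ.+-cong (toℚᵘ-fromℚᵘ (mkℚᵘ (+ x) 0)) (toℚᵘ-fromℚᵘ (mkℚᵘ (+ y) c)) ⟩
    mkℚᵘ (+ x) 0 ℚᵘ.+ mkℚᵘ (+ y) c
      ≤⟨ x/1+y/c≤D/mᵘ x y c D m h ⟩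
    mkℚᵘ (+ D) m
      ≃⟨ toℚᵘ-fromℚᵘ (mkℚᵘ (+ D) m) ⟨
    toℚᵘ (+ D / suc m)
      ∎)
    where open ℚᵘ.≤-Reasoning

open import Defs
open import Data.Nat using (ℕ; zero; suc; _<_; _≤_; _∸_; >-nonZero)
open import Data.Product using (_×_; ∃; _,_)
open import Data.Integer using (+_)
open import Data.Rational using (_/_; _+_) renaming (_≤_ to _≤ℚ_)
open import Relation.Binary.PropositionalEquality using (_≡_)

open DegreeSumBounds using (degreeSum-bound; degreeSum-bound′; x/1+y/c≤D/m)

proposition2p3 : (δ k : ℕ) → 0 < δ → (k>0 : 0 < k) → δ < k →
    ∀ {n} (G : Graph n) →
    (∀ v → δ ≤ degree G v) → (∃ λ v → degree G v ≡ δ) →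
    (∀ v → degree G v ≡ δ → ∃ λ u → Adjacent G v u × k ≤ degree G u) →
    ((+ δ / 1) + (+ (k ∸ δ) / suc k) ≤ℚ avgDegree G)
    × ((∀ v → k ≤ degree G v → ∃ λ u → Adjacent G v u × δ < degree G u) →
       (+ δ / 1) + (_/_ (+ (k ∸ δ)) k {{ >-nonZero k>0 }}) ≤ℚ avgDegree G)
proposition2p3 _ _       _ _  _   {zero}  _ _ (() , _) _
proposition2p3 _ zero    _ () _   {suc n} _ _ _ _
proposition2p3 δ (suc k) _ _ δ<k {suc n} G δ≤degree _ has-large-neighbour =
    x/1+y/c≤D/m δ (suc k ∸ δ) (suc k) (degreeSum G) n
      (degreeSum-bound G δ<k δ≤degree has-large-neighbour)
  , λ has-nonminimal-neighbour → x/1+y/c≤D/m δ (suc k ∸ δ) k (degreeSum G) n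
      (degreeSum-bound′ G δ<k δ≤degree has-large-neighbour has-nonminimal-neighbour)
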